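{- Let $\pi\in G_{r,n}$ be monochromatic, i.e. $\epsilon(\pi(1))=\cdots=\epsilon(\pi(n))$. Then for every integer $j\ge0$, \[ \Omega_{P(\pi)}(j)=\binom{rj+n-\mathrm{intdes}(\pi)}{n}. \]
   Context: Fix integers $r\ge1$, $n\ge1$. For a totally ordered set $Y$, $Y_{(r)}=\{0,\dots,r-1\}\times Y$ with the lexicographic order; write $x_k$ for $(k,x)$, $Y_k=\{k\}\times Y$, $|x_k|=x$, $\epsilon(x_k)=k$; color subscripts are read modulo $r$; $[n]=\{1,\dots,n\}$, $[0,n]=\{0,\dots,n\}$. $G_{r,n}$ is the group of bijections $\pi$ of $[n]_{(r)}$ with $\pi(i_j)=k_l\Rightarrow\pi(i_{j+a})=k_{l+a}$ (mod $r$), written in one-line notation $\pi(1)\cdots\pi(n)$, $\pi(i)=\pi(i_0)$. $\mathrm{Des}(\pi)=\{i\in[n]:\pi(i)>\pi(i+1)\}$ (order of $[0,n]_{(r)}$, with $\pi(n+1)=0_1$), $\mathrm{intDes}(\pi)=\mathrm{Des}(\pi)\cap[n-1]$, $\mathrm{intdes}(\pi)=|\mathrm{intDes}(\pi)|$. An $r$-colored poset is a finite set $P=\{0_1,\dots,0_{r-1}\}\cup Q$, $Q\subseteq[n]_{(r)}$ with distinct absolute values, with partial order $\prec$ such that $0_1\prec\cdots\prec0_{r-1}$. With $X=[0,j]$, a colored $P$-partition is a map $f:P\to X_{(r)}$ with (i) $f(0_k)=(k,0)$; (ii) $a\prec b\Rightarrow f(a)\le f(b)$; (iii) if $a\prec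 b$, $f(a),f(b)\in X_k$ for the same $k$, and $|a|_{\epsilon(a)-k}>|b|_{\epsilon(b)-k}$ in $[0,n]_{(r)}$, then $f(a)<f(b)$; (iv) if $f(a)=(k,j)$ then $\epsilon(a)=k$. $\Omega_P(j)$ is the number of such $f$. For $\pi\in G_{r,n}$, $P(\pi)$ is the colored poset on $\{0_1,\dots,0_{r-1},\pi(1),\dots,\pi(n)\}$ that is the disjoint union of the two chains $0_1\prec\cdots\prec0_{r-1}$ and $\pi(1)\prec\cdots\prec\pi(n)$ (no relations between them). -}

module Defs where

open import Data.Nat using (ℕ; zero; suc; _+_; _*_; _∸_; _<_; _<?_; NonZero)
open import Data.Nat.DivMod using (_mod_)
open import Data.Fin using (Fin; toℕ; fromℕ; _≟_) renaming (zero to fzero; suc to fsuc)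
open import Data.Product using (Σ; _×_; _,_; proj₁; proj₂)
open import Data.Sum using (_⊎_)
open import Data.List using (List; []; _∷_; length; map; allFin)
open import Data.List.Membership.Propositional using (_∈_)
open import Data.List.Relation.Unary.Unique.Propositional using (Unique)
open import Data.Vec using (Vec; lookup)
open import Function.Bundles using (_↔_; Inverse)
open import Relation.Binary.PropositionalEquality using (_≡_)
open import Relation.Nullary using (Dec; yes; no)
open import Relation.Nullary.Decidable using (_⊎-dec_; _×-dec_)

HasCard : {A : Set} → (A → Set) → ℕ → Set
HasCard {A} P N =
  Σ (List A) λ L → Unique L × (∀ x → x ∈ L → P x) × (∀ x → P x → x ∈ L) × length L ≡ N

-- Colours.  Throughout r = suc r' (so r ≥ 1); colours are Fin r and
-- arithmetic on colours is modulo r.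

_+c_ : ∀ {r'} → Fin (suc r') → ℕ → Fin (suc r')
_+c_ {r'} k a = (toℕ k + a) mod (suc r')

_-c_ : ∀ {r'} → Fin (suc r') → Fin (suc r') → Fin (suc r')
_-c_ {r'} a k = (toℕ a + (suc r' ∸ toℕ k)) mod (suc r')

-- Y_(r) for Y ⊆ ℕ: an element x_k = (k , x) is a pair (colour , value);
-- lexicographic order.

_<L_ : ∀ {r} → Fin r × ℕ → Fin r × ℕ → Set
(k , x) <L (k' , x') = (toℕ k < toℕ k') ⊎ ((k ≡ k') × (x < x'))

_≤L_ : ∀ {r} → Fin r × ℕ → Fin r × ℕ → Set
a ≤L b = (a <L b) ⊎ (a ≡ b)

_<L?_ : ∀ {r} (a b : Fin r × ℕ) → Dec (a <L b)
(k , x) <L? (k' , x') = (toℕ k <? toℕ k') ⊎-dec ((k ≟ k') ×-dec (x <? x'))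

-- The coloured permutation group G_{r,n}.
-- [n]_(r) is represented by Fin r × Fin n, where (k , i) stands for the
-- element (toℕ i + 1)_k, i.e. absolute value toℕ i + 1 and colour k.

record ColoredPerm (r' n : ℕ) : Set where
  field
    bij : (Fin (suc r') × Fin n) ↔ (Fin (suc r') × Fin n)
    equivariant : ∀ (j : Fin (suc r')) (i : Fin n) (a : ℕ) →
      Inverse.to bij (j +c a , i)
        ≡ (proj₁ (Inverse.to bij (j , i)) +c a , proj₂ (Inverse.to bij (j , i)))

module _ {r' n : ℕ} (π : ColoredPerm r' n) where
  open ColoredPerm π

  -- π(i) = π(i_0), for i ∈ Fin n standing for i+1 ∈ [n];
  -- returned as an element of [0,n]_(r): (colour , absolute value)
  πval : Fin n → Fin (suc r') × ℕ
  πval i = proj₁ (Inverse.to bij (fzero , i)) , suc (toℕ (proj₂ (Inverse.to bij (fzero , i))))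

  πcol : Fin n → Fin (suc r')
  πcol i = proj₁ (πval i)

Monochromatic : ∀ {r' n} → ColoredPerm r' n → Set
Monochromatic π = ∀ i i' → πcol π i ≡ πcol π i'

descFrom : ∀ {r} → Fin r × ℕ → List (Fin r × ℕ) → ℕ
descFrom x [] = 0
descFrom x (y ∷ rest) with y <L? x
... | yes _ = suc (descFrom y rest)
... | no _ = descFrom y rest

descCount : ∀ {r} → List (Fin r × ℕ) → ℕ
descCount [] = 0
descCount (x ∷ rest) = descFrom x rest

intdes : ∀ {r' n} → ColoredPerm r' n → ℕ
intdes {n = n} π = descCount (map (πval π) (allFin n))

-- Coloured posets of the shape {0_1,…,0_{r-1}} ∪ Q with |Q| = m.
-- Indices: zeroE i is 0_{i+1} (i : Fin r'), qE i is the i-th element of Q.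

data PIdx (r' m : ℕ) : Set where
  zeroE : Fin r' → PIdx r' m
  qE    : Fin m → PIdx r' m

record ColoredPoset (r' m : ℕ) : Set₁ where
  field
    elt : PIdx r' m → Fin (suc r') × ℕ
    _≺_ : PIdx r' m → PIdx r' m → Set

-- element of X_(r), X = [0,j]: (colour , value)
XElt : ℕ → ℕ → Set
XElt r' j = Fin (suc r') × Fin (suc j)

toL : ∀ {r' j} → XElt r' j → Fin (suc r') × ℕ
toL (k , x) = k , toℕ x

-- a map f : P → X_(r), given by its values on 0_1..0_{r-1} and on Q
Map : ℕ → ℕ → ℕ → Set
Map r' m j = Vec (XElt r' j) r' × Vec (XElt r' j) m

app : ∀ {r' m j} → Map r' m j → PIdx r' m → XElt r' j
app (f0 , fQ) (zeroE i) = lookup f0 i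
app (f0 , fQ) (qE i)    = lookup fQ i

module _ {r' m : ℕ} (P : ColoredPoset r' m) (j : ℕ) where
  open ColoredPoset P

  ε : PIdx r' m → Fin (suc r')
  ε a = proj₁ (elt a)

  ∣_∣ : PIdx r' m → ℕ
  ∣ a ∣ = proj₂ (elt a)

  record IsColoredPPartition (f : Map r' m j) : Set where
    field
      cond-i   : ∀ (i : Fin r') → app f (zeroE i) ≡ (fsuc i , fzero)
      cond-ii  : ∀ a b → a ≺ b → toL (app f a) ≤L toL (app f b)
      cond-iii : ∀ a b (k : Fin (suc r')) → a ≺ b →
                 proj₁ (app f a) ≡ k → proj₁ (app f b) ≡ k →
                 (ε b -c k , ∣ b ∣) <L (ε a -c k , ∣ a ∣) →
                 toL (app f a) <L toL (app f b)
      cond-iv  : ∀ a (k : Fin (suc r')) → app f a ≡ (k , fromℕ j) → ε a ≡ k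

  ΩIs : ℕ → Set
  ΩIs N = HasCard IsColoredPPartition N

data PπOrd {r' n : ℕ} : PIdx r' n → PIdx r' n → Set where
  zz : ∀ {i i'} → toℕ i < toℕ i' → PπOrd (zeroE i) (zeroE i')
  qq : ∀ {i i'} → toℕ i < toℕ i' → PπOrd (qE i) (qE i')

Pπ : ∀ {r' n} → ColoredPerm r' n → ColoredPoset r' n
Pπ π = record
  { elt = λ { (zeroE i) → fsuc i , 0 ; (qE i) → πval π i }
  ; _≺_ = PπOrd
  }

-- Since π is monochromatic, the premise of condition (iii) for π(i) ≺ π(i') says just
-- |π(i')| < |π(i)|.  Hence f is a P(π)-partition iff f(0_k) = (k,0), every value v_i = f(π(i))
-- is allowed by (iv) (the value j occurs only in the colour c of π), and the pairs (v_i, π(i))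
-- increase weakly in the lexicographic order.  That order is transitive, so it suffices to
-- ask it of neighbours: v is weakly increasing, and strictly so at each descent of π.
-- There are rj + 1 allowed values, and an ordered set of size N carries C(N + w, n) such
-- sequences of length n with w weak steps (Pascal's rule, splitting on whether the least
-- element is used); here w = n - 1 - intdes(π).
module Submission where

open import Defs
open import Data.Bool using (Bool; true; false)
open import Data.Empty using (⊥-elim)
open import Data.Fin as Fin using (Fin; toℕ; fromℕ; inject₁; _≟_) renaming (zero to fzero; suc to fsuc)
import Data.Fin.Properties as Fin
open import Data.List using (List; []; _∷_; [_]; length; map; _++_; concat; tabulate; allFin)
open import Data.List.Properties using (length-++; length-map; length-tabulate; map-tabulate)
open import Data.List.Membership.Propositional using (_∈_)
open import Data.List.Membership.Propositional.Properties
  using (∈-map⁺; ∈-map⁻; ∈-++⁺ˡ; ∈-++⁺ʳ; ∈-++⁻; ∈-tabulate⁺; ∈-tabulate⁻; ∈-allFin; ∈-concat⁺′; ∈-concat⁻′)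
import Data.List.Relation.Unary.All as ListAll
import Data.List.Relation.Unary.All.Properties as ListAll
open import Data.List.Relation.Unary.Any using (here; there)
open import Data.List.Relation.Unary.AllPairs using (AllPairs; []; _∷_)
import Data.List.Relation.Unary.AllPairs as AllPairs
import Data.List.Relation.Unary.AllPairs.Properties as AllPairs
open import Data.List.Relation.Unary.Unique.Propositional using (Unique)
import Data.List.Relation.Unary.Unique.Propositional.Properties as Unique
open import Data.List.Relation.Binary.Disjoint.Propositional using (Disjoint)
open import Data.Nat as ℕ using (ℕ; zero; suc; _+_; _*_; _∸_; z<s; s<s; s≤s)
import Data.Nat.Properties as ℕ
open import Data.Nat.Combinatorics using (_C_; k>n⇒nCk≡0; nCk+nC[k+1]≡[n+1]C[k+1])
open import Data.Nat.ListAction using (sum)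
open import Data.Nat.Tactic.RingSolver using (solve-∀)
open import Data.Product using (_×_; _,_; proj₁; proj₂)
open import Data.Product.Properties using (,-injectiveʳ; ×-≡,≡→≡)
open import Data.Product.Relation.Binary.Lex.Strict
  using (×-Lex; ×-transitive; ×-isStrictPartialOrder; ×-isStrictTotalOrder)
open import Data.Sum using (_⊎_; inj₁; inj₂)
open import Data.Vec as Vec using (Vec; []; _∷_; lookup)
import Data.Vec.Properties as Vec
open import Data.Vec.Relation.Unary.All as All using (All; []; _∷_)
import Data.Vec.Relation.Unary.All.Properties as All
open import Function using (_∘_; id)
open import Relation.Binary.Definitions using (Transitive; tri<; tri≈; tri>)
open import Relation.Binary.Structures using (IsStrictTotalOrder; IsStrictPartialOrder)
open import Relation.Binary.PropositionalEquality
  using (_≡_; _≢_; refl; sym; trans; cong; cong₂; subst; subst₂; isEquivalence; resp₂; module ≡-Reasoning)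
open import Relation.Nullary using (Dec; yes; no; ¬_)
open import Relation.Nullary.Decidable using (isYes)

weakSteps : ∀ {m} → Vec Bool m → ℕ
weakSteps []           = 0
weakSteps (true ∷ bs)  = weakSteps bs
weakSteps (false ∷ bs) = suc (weakSteps bs)

weakSteps≤length : ∀ {m} (bs : Vec Bool m) → weakSteps bs ℕ.≤ m
weakSteps≤length []           = ℕ.z≤n
weakSteps≤length (true ∷ bs)  = ℕ.m≤n⇒m≤1+n (weakSteps≤length bs)
weakSteps≤length (false ∷ bs) = s≤s (weakSteps≤length bs)

length-concat : ∀ {A : Set} (xss : List (List A)) → length (concat xss) ≡ sum (map length xss)
length-concat []         = refl
length-concat (xs ∷ xss) = trans (length-++ xs) (cong (length xs +_) (length-concat xss))

sum-tabulate-const : ∀ {n a} (f : Fin n → ℕ) → (∀ i → f i ≡ a) → sum (tabulate f) ≡ n * a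
sum-tabulate-const {zero}  f f≡a = refl
sum-tabulate-const {suc n} f f≡a = cong₂ _+_ (f≡a fzero) (sum-tabulate-const (f ∘ fsuc) (f≡a ∘ fsuc))

sum-tabulate-bump : ∀ {n a} (c : Fin n) (f : Fin n → ℕ) →
                    f c ≡ suc a → (∀ i → i ≢ c → f i ≡ a) → sum (tabulate f) ≡ n * a + 1
sum-tabulate-bump {suc n} {a} fzero f fc≡ f≡ =
  trans (cong₂ _+_ fc≡ (sum-tabulate-const (f ∘ fsuc) (λ i → f≡ (fsuc i) λ ())))
        (sym (ℕ.+-comm (a + n * a) 1))
sum-tabulate-bump {suc n} {a} (fsuc c) f fc≡ f≡ =
  trans (cong₂ _+_ (f≡ fzero λ ())
                   (sum-tabulate-bump c (f ∘ fsuc) fc≡ λ i i≢c → f≡ (fsuc i) (i≢c ∘ Fin.suc-injective)))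
        (sym (ℕ.+-assoc a (n * a) 1))

module Chains {A : Set} {_<_ : A → A → Set}
              (<-trans : Transitive _<_) (<-irrefl : ∀ {x} → ¬ x < x) where

  _≤_ : A → A → Set
  x ≤ y = x < y ⊎ x ≡ y

  <-≤-trans : ∀ {x y z} → x < y → y ≤ z → x < z
  <-≤-trans x<y (inj₁ y<z) = <-trans x<y y<z
  <-≤-trans x<y (inj₂ refl) = x<y

  ≤-trans : Transitive _≤_
  ≤-trans (inj₁ x<y) y≤z = inj₁ (<-≤-trans x<y y≤z)
  ≤-trans (inj₂ refl) y≤z = y≤z

  Step : Bool → A → A → Set
  Step true  = _<_
  Step false = _≤_

  Step⇒≤ : ∀ b {x y} → Step b x y → x ≤ y
  Step⇒≤ true  = inj₁
  Step⇒≤ false = id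

  Step-≤-trans : ∀ b {x y z} → Step b x y → y ≤ z → Step b x z
  Step-≤-trans true  = <-≤-trans
  Step-≤-trans false = ≤-trans

  data Chain : ∀ {m} → Vec Bool m → Vec A (suc m) → Set where
    [-] : ∀ {x} → Chain [] (x ∷ [])
    _∷_ : ∀ {m b x y} {bs : Vec Bool m} {v : Vec A m} →
          Step b x y → Chain bs (y ∷ v) → Chain (b ∷ bs) (x ∷ y ∷ v)

  chain-head-≤ : ∀ {m} {bs : Vec Bool m} {x v} → Chain bs (x ∷ v) → All (x ≤_) v
  chain-head-≤ [-] = []
  chain-head-≤ (_∷_ {b = b} s ch) = Step⇒≤ b s ∷ All.map (≤-trans (Step⇒≤ b s)) (chain-head-≤ ch)

  chain-head-Step : ∀ {m b} {bs : Vec Bool m} {x v} → Chain (b ∷ bs) (x ∷ v) → All (Step b x) v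
  chain-head-Step (_∷_ {b = b} s ch) = s ∷ All.map (Step-≤-trans b s) (chain-head-≤ ch)

  Sorted : List A → Set
  Sorted = AllPairs _<_

  -- the entries allowed after x, when x is the least element of x ∷ L
  after : Bool → A → List A → List A
  after true  x L = L
  after false x L = x ∷ L

  Sorted-after : ∀ b {x L} → Sorted (x ∷ L) → Sorted (after b x L)
  Sorted-after true  (_ ∷ sorted) = sorted
  Sorted-after false sorted       = sorted

  after⊆ : ∀ b {x L y} → y ∈ after b x L → y ∈ x ∷ L
  after⊆ true  = there
  after⊆ false = id

  ∈-after⇒Step : ∀ b {x L y} → Sorted (x ∷ L) → y ∈ after b x L → Step b x y
  ∈-after⇒Step true  (x<L ∷ _) y∈ = ListAll.lookup x<L y∈
  ∈-after⇒Step false _ (here refl) = inj₂ refl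
  ∈-after⇒Step false (x<L ∷ _) (there y∈) = inj₁ (ListAll.lookup x<L y∈)

  Step⇒∈-after : ∀ b {x L y} → y ∈ x ∷ L → Step b x y → y ∈ after b x L
  Step⇒∈-after true  (here refl) x<x = ⊥-elim (<-irrefl x<x)
  Step⇒∈-after true  (there y∈)  _   = y∈
  Step⇒∈-after false y∈          _   = y∈

  ∈-tail : ∀ {x y L} → x < y → y ∈ x ∷ L → y ∈ L
  ∈-tail x<x (here refl) = ⊥-elim (<-irrefl x<x)
  ∈-tail _   (there y∈)  = y∈

  -- chainsFrom x L bs lists the tails w of the chains x ∷ w with entries in x ∷ L.
  chains     : ∀ {m} → List A → Vec Bool m → List (Vec A (suc m))
  chainsFrom : ∀ {m} → A → List A → Vec Bool m → List (Vec A m)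
  chains []      bs = []
  chains (x ∷ L) bs = map (x ∷_) (chainsFrom x L bs) ++ chains L bs
  chainsFrom x L []       = [ [] ]
  chainsFrom x L (b ∷ bs) = chains (after b x L) bs

  ∈-chains⁻     : ∀ {m L} {bs : Vec Bool m} {v} → Sorted L →
                  v ∈ chains L bs → All (_∈ L) v × Chain bs v
  ∈-chainsFrom⁻ : ∀ {m x L} (bs : Vec Bool m) {w} → Sorted (x ∷ L) →
                  w ∈ chainsFrom x L bs → All (_∈ x ∷ L) w × Chain bs (x ∷ w)
  ∈-chains⁻ {L = x ∷ L} {bs} sorted@(_ ∷ sortedL) v∈ with ∈-++⁻ (map (x ∷_) (chainsFrom x L bs)) v∈
  ... | inj₂ v∈ʳ with ∈-chains⁻ sortedL v∈ʳ
  ...   | v⊆ , ch = All.map there v⊆ , ch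
  ∈-chains⁻ {L = x ∷ L} {bs} sorted v∈ | inj₁ v∈ˡ with ∈-map⁻ (x ∷_) v∈ˡ
  ... | w , w∈ , refl with ∈-chainsFrom⁻ bs sorted w∈
  ...   | w⊆ , ch = here refl ∷ w⊆ , ch
  ∈-chainsFrom⁻ []       _      (here refl) = [] , [-]
  ∈-chainsFrom⁻ (b ∷ bs) sorted w∈ with ∈-chains⁻ (Sorted-after b sorted) w∈
  ... | y∈ ∷ w⊆ , ch = after⊆ b y∈ ∷ All.map (after⊆ b) w⊆ , ∈-after⇒Step b sorted y∈ ∷ ch

  ∈-chains⁺     : ∀ {m L} {bs : Vec Bool m} {v} → Sorted L →
                  All (_∈ L) v → Chain bs v → v ∈ chains L bs
  ∈-chainsFrom⁺ : ∀ {m x L} (bs : Vec Bool m) {w} → Sorted (x ∷ L) →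
                  All (_∈ x ∷ L) w → Chain bs (x ∷ w) → w ∈ chainsFrom x L bs
  ∈-chains⁺ {L = y ∷ L} {bs} sorted (here refl ∷ w⊆) ch =
    ∈-++⁺ˡ (∈-map⁺ (y ∷_) (∈-chainsFrom⁺ bs sorted w⊆ ch))
  ∈-chains⁺ {L = y ∷ L} {bs} (y<L ∷ sortedL) (there x∈ ∷ w⊆) ch =
    ∈-++⁺ʳ (map (y ∷_) (chainsFrom y L bs))
      (∈-chains⁺ sortedL (x∈ ∷ All.map (λ (z∈ , x≤z) → ∈-tail (<-≤-trans y<x x≤z) z∈)
                                        (All.zip (w⊆ , chain-head-≤ ch))) ch)
    where y<x = ListAll.lookup y<L x∈
  ∈-chainsFrom⁺ []       _      []  [-] = here refl
  ∈-chainsFrom⁺ (b ∷ bs) sorted w⊆ ch@(_ ∷ ch′) =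
    ∈-chains⁺ (Sorted-after b sorted)
      (All.map (λ (y∈ , s) → Step⇒∈-after b y∈ s) (All.zip (w⊆ , chain-head-Step ch))) ch′

  chains-unique     : ∀ {m L} (bs : Vec Bool m) → Sorted L → Unique (chains L bs)
  chainsFrom-unique : ∀ {m x L} (bs : Vec Bool m) → Sorted (x ∷ L) → Unique (chainsFrom x L bs)
  chains-unique {L = []}    bs _ = []
  chains-unique {L = x ∷ L} bs sorted@(x<L ∷ sortedL) =
    Unique.++⁺ (Unique.map⁺ Vec.∷-injectiveʳ (chainsFrom-unique bs sorted))
               (chains-unique bs sortedL) disjoint
    where
      disjoint : Disjoint (map (x ∷_) (chainsFrom x L bs)) (chains L bs)
      disjoint (v∈ˡ , v∈ʳ) with ∈-map⁻ (x ∷_) v∈ˡ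
      ... | _ , _ , refl with ∈-chains⁻ sortedL v∈ʳ
      ...   | x∈L ∷ _ , _ = <-irrefl (ListAll.lookup x<L x∈L)
  chainsFrom-unique []       _      = ListAll.[] ∷ []
  chainsFrom-unique (b ∷ bs) sorted = chains-unique bs (Sorted-after b sorted)

  -- Pascal's rule, split on whether the least element of L is the first entry.
  length-chains     : ∀ {m} L (bs : Vec Bool m) →
                      length (chains L bs) ≡ (length L + weakSteps bs) C suc m
  length-chainsFrom : ∀ {m} x L (bs : Vec Bool m) →
                      length (chainsFrom x L bs) ≡ (length L + weakSteps bs) C m
  length-chains []      bs = sym (k>n⇒nCk≡0 (s≤s (weakSteps≤length bs)))
  length-chains {m} (x ∷ L) bs = begin
    length (map (x ∷_) (chainsFrom x L bs) ++ chains L bs)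
      ≡⟨ length-++ (map (x ∷_) (chainsFrom x L bs)) ⟩
    length (map (x ∷_) (chainsFrom x L bs)) + length (chains L bs)
      ≡⟨ cong₂ _+_ (trans (length-map (x ∷_) (chainsFrom x L bs)) (length-chainsFrom x L bs))
                   (length-chains L bs) ⟩
    (length L + weakSteps bs) C m + (length L + weakSteps bs) C suc m
      ≡⟨ nCk+nC[k+1]≡[n+1]C[k+1] (length L + weakSteps bs) m ⟩
    suc (length L + weakSteps bs) C suc m ∎
    where open ≡-Reasoning
  length-chainsFrom x L []       = refl
  length-chainsFrom x L (true ∷ bs)  = length-chains L bs
  length-chainsFrom {suc m} x L (false ∷ bs) =
    trans (length-chains (x ∷ L) bs) (cong (_C suc m) (sym (ℕ.+-suc (length L) (weakSteps bs))))

<L-isStrictTotalOrder : ∀ {r} → IsStrictTotalOrder _ (_<L_ {r})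
<L-isStrictTotalOrder = ×-isStrictTotalOrder Fin.<-isStrictTotalOrder ℕ.<-isStrictTotalOrder

module _ {r : ℕ} where
  open IsStrictTotalOrder (<L-isStrictTotalOrder {r}) using (compare; irrefl) renaming (trans to <L-trans)

  <L-irrefl : ∀ {p : Fin r × ℕ} → ¬ p <L p
  <L-irrefl = irrefl (refl , refl)

  ≤L-trans : Transitive (_≤L_ {r})
  ≤L-trans (inj₁ p<q) (inj₁ q<s) = inj₁ (<L-trans p<q q<s)
  ≤L-trans (inj₁ p<q) (inj₂ refl) = inj₁ p<q
  ≤L-trans (inj₂ refl) q≤s = q≤s

  ≮L⇒≥L : ∀ {p q : Fin r × ℕ} → ¬ q <L p → p ≤L q
  ≮L⇒≥L {p} {q} q≮p with compare p q
  ... | tri< p<q _ _ = inj₁ p<q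
  ... | tri≈ _ p≈q _ = inj₂ (×-≡,≡→≡ p≈q)
  ... | tri> _ _ q<p = ⊥-elim (q≮p q<p)

  <L⇒≱L : ∀ {p q : Fin r × ℕ} → q <L p → ¬ p ≤L q
  <L⇒≱L q<p (inj₁ p<q)  = <L-irrefl (<L-trans q<p p<q)
  <L⇒≱L q<p (inj₂ refl) = <L-irrefl q<p

  <L-sameColour⇒< : ∀ {a b : Fin r} {u w} → a ≡ b → (a , u) <L (b , w) → u ℕ.< w
  <L-sameColour⇒< refl (inj₁ a<a)      = ⊥-elim (ℕ.<-irrefl refl a<a)
  <L-sameColour⇒< refl (inj₂ (_ , u<w)) = u<w

  descentPattern : ∀ {m} → (Fin (suc m) → Fin r × ℕ) → Vec Bool m
  descentPattern {zero}  p = []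
  descentPattern {suc m} p = isYes (p (fsuc fzero) <L? p fzero) ∷ descentPattern (p ∘ fsuc)

  descFrom+weakSteps : ∀ {m} (p : Fin (suc m) → Fin r × ℕ) →
                       descFrom (p fzero) (tabulate (p ∘ fsuc)) + weakSteps (descentPattern p) ≡ m
  descFrom+weakSteps {zero}  p = refl
  descFrom+weakSteps {suc m} p with p (fsuc fzero) <L? p fzero
  ... | yes _ = cong suc (descFrom+weakSteps (p ∘ fsuc))
  ... | no  _ = trans (ℕ.+-suc _ _) (cong suc (descFrom+weakSteps (p ∘ fsuc)))

module KeyedChains {r : ℕ} {A : Set} {_<_ : A → A → Set}
                   (<-trans : Transitive _<_) (<-irrefl : ∀ {x} → ¬ x < x) where
  open Chains {_<_ = _<_} <-trans <-irrefl

  _⊑_ : A × (Fin r × ℕ) → A × (Fin r × ℕ) → Set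
  _⊑_ = ×-Lex _≡_ _<_ _≤L_

  ⊑-trans : Transitive _⊑_
  ⊑-trans = ×-transitive {_<₂_ = _≤L_} isEquivalence (resp₂ _<_) <-trans ≤L-trans

  Step⇒⊑ : ∀ {x y p q} → Step (isYes (q <L? p)) x y → (x , p) ⊑ (y , q)
  Step⇒⊑ {p = p} {q} s with q <L? p
  Step⇒⊑ x<y         | yes _   = inj₁ x<y
  Step⇒⊑ (inj₁ x<y)  | no _    = inj₁ x<y
  Step⇒⊑ (inj₂ refl) | no q≮p  = inj₂ (refl , ≮L⇒≥L q≮p)

  ⊑⇒Step : ∀ {x y p q} → (x , p) ⊑ (y , q) → Step (isYes (q <L? p)) x y
  ⊑⇒Step {p = p} {q} x⊑y with q <L? p
  ⊑⇒Step (inj₁ x<y)          | yes _   = x<y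
  ⊑⇒Step (inj₂ (refl , p≤q)) | yes q<p = ⊥-elim (<L⇒≱L q<p p≤q)
  ⊑⇒Step (inj₁ x<y)          | no _    = inj₁ x<y
  ⊑⇒Step (inj₂ (refl , _))   | no _    = inj₂ refl

  LexSorted : ∀ {n} → Vec A n → (Fin n → Fin r × ℕ) → Set
  LexSorted v p = ∀ {i i'} → i Fin.< i' → (lookup v i , p i) ⊑ (lookup v i' , p i')

  chain⇒LexSorted : ∀ {m} {v : Vec A (suc m)} {p} → Chain (descentPattern p) v → LexSorted v p
  chain⇒LexSorted {zero} [-] {fzero} {fzero} ()
  chain⇒LexSorted {suc m} (s ∷ ch) {fzero} {fsuc fzero} _ = Step⇒⊑ s
  chain⇒LexSorted {suc m} (s ∷ ch) {fzero} {fsuc (fsuc i')} _ =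
    ⊑-trans (Step⇒⊑ s) (chain⇒LexSorted ch {fzero} {fsuc i'} z<s)
  chain⇒LexSorted {suc m} (s ∷ ch) {fsuc i} {fsuc i'} (s<s i<i') = chain⇒LexSorted ch i<i'

  LexSorted⇒chain : ∀ {m} (v : Vec A (suc m)) p → LexSorted v p → Chain (descentPattern p) v
  LexSorted⇒chain (x ∷ [])    p sorted = [-]
  LexSorted⇒chain (x ∷ y ∷ v) p sorted =
    ⊑⇒Step (sorted {fzero} {fsuc fzero} z<s) ∷
    LexSorted⇒chain (y ∷ v) (p ∘ fsuc) (λ {i} {i'} i<i' → sorted {fsuc i} {fsuc i'} (s<s i<i'))

module _ {r' j : ℕ} where
  _<X_ : XElt r' j → XElt r' j → Set
  x <X y = toL x <L toL y

  <X-isStrictPartialOrder : IsStrictPartialOrder _ _<X_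
  <X-isStrictPartialOrder = ×-isStrictPartialOrder Fin.<-isStrictPartialOrder Fin.<-isStrictPartialOrder

  <X-trans : Transitive _<X_
  <X-trans = IsStrictPartialOrder.trans <X-isStrictPartialOrder

  <X-irrefl : ∀ {x} → ¬ x <X x
  <X-irrefl = IsStrictPartialOrder.irrefl <X-isStrictPartialOrder (refl , refl)

  toL-injective : ∀ {x y : XElt r' j} → toL x ≡ toL y → x ≡ y
  toL-injective e = ×-≡,≡→≡ (cong proj₁ e , Fin.toℕ-injective (cong proj₂ e))

-- Allowed x: condition (iv) permits x as the value of an element of colour c.
module AllowedValues (r' j : ℕ) (c : Fin (suc r')) where

  Allowed : XElt r' j → Set
  Allowed (k , x) = x ≡ fromℕ j → k ≡ c

  values : ∀ {k} → Dec (k ≡ c) → List (Fin (suc j))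
  values (yes _) = allFin (suc j)
  values (no _)  = tabulate inject₁

  ∈-values⁺ : ∀ {k x} (d : Dec (k ≡ c)) → Allowed (k , x) → x ∈ values d
  ∈-values⁺         (yes _)   _       = ∈-allFin _
  ∈-values⁺ {x = x} (no k≢c) allowed =
    subst (_∈ tabulate inject₁) (Fin.inject₁-lower₁ x j≢x) (∈-tabulate⁺ _)
    where
      j≢x : j ≢ toℕ x
      j≢x j≡x = k≢c (allowed (Fin.toℕ-injective (trans (sym j≡x) (sym (Fin.toℕ-fromℕ j)))))

  ∈-values⁻ : ∀ {k x} (d : Dec (k ≡ c)) → x ∈ values d → Allowed (k , x)
  ∈-values⁻ (yes k≡c) _  _   = k≡c
  ∈-values⁻ (no _)    x∈ x≡j with ∈-tabulate⁻ x∈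
  ... | _ , refl = ⊥-elim (Fin.fromℕ≢inject₁ (sym x≡j))

  values-sorted : ∀ {k} (d : Dec (k ≡ c)) → AllPairs Fin._<_ (values d)
  values-sorted (yes _) = AllPairs.tabulate⁺-< id
  values-sorted (no _)  = AllPairs.tabulate⁺-< λ {i} {i'} i<i' →
    subst₂ ℕ._<_ (sym (Fin.toℕ-inject₁ i)) (sym (Fin.toℕ-inject₁ i')) i<i'

  length-values-yes : ∀ {k} → k ≡ c → (d : Dec (k ≡ c)) → length (values d) ≡ suc j
  length-values-yes _   (yes _)  = length-tabulate id
  length-values-yes k≡c (no k≢c) = ⊥-elim (k≢c k≡c)

  length-values-no : ∀ {k} → k ≢ c → (d : Dec (k ≡ c)) → length (values d) ≡ j
  length-values-no k≢c (yes k≡c) = ⊥-elim (k≢c k≡c)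
  length-values-no _   (no _)    = length-tabulate inject₁

  block : Fin (suc r') → List (XElt r' j)
  block k = map (k ,_) (values (k ≟ c))

  ∈-block⁺ : ∀ {k x} → Allowed (k , x) → (k , x) ∈ block k
  ∈-block⁺ {k} allowed = ∈-map⁺ (k ,_) (∈-values⁺ (k ≟ c) allowed)

  ∈-block⁻ : ∀ {k y} → y ∈ block k → proj₁ y ≡ k × Allowed y
  ∈-block⁻ {k} y∈ with ∈-map⁻ (k ,_) y∈
  ... | _ , x∈ , refl = refl , ∈-values⁻ (k ≟ c) x∈

  block-sorted : ∀ k → AllPairs _<X_ (block k)
  block-sorted k = AllPairs.map⁺ (AllPairs.map (λ x<y → inj₂ (refl , x<y)) (values-sorted (k ≟ c)))

  allowedList : List (XElt r' j)
  allowedList = concat (tabulate block)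

  ∈-allowedList⁺ : ∀ y → Allowed y → y ∈ allowedList
  ∈-allowedList⁺ (k , x) allowed =
    ∈-concat⁺′ (∈-block⁺ allowed) (∈-tabulate⁺ {f = block} k)

  ∈-allowedList⁻ : ∀ {y} → y ∈ allowedList → Allowed y
  ∈-allowedList⁻ y∈ with ∈-concat⁻′ (tabulate block) y∈
  ... | _ , y∈xs , xs∈ with ∈-tabulate⁻ {f = block} xs∈
  ...   | _ , refl = proj₂ (∈-block⁻ y∈xs)

  allowedList-sorted : AllPairs _<X_ allowedList
  allowedList-sorted = AllPairs.concat⁺ (ListAll.tabulate⁺ block-sorted) (AllPairs.tabulate⁺-< blocks-ordered)
    where
      blocks-ordered : ∀ {k k'} → k Fin.< k' → ListAll.All (λ y → ListAll.All (y <X_) (block k')) (block k)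
      blocks-ordered k<k' = ListAll.tabulate λ y∈ → ListAll.tabulate λ z∈ →
        inj₁ (subst₂ Fin._<_ (sym (proj₁ (∈-block⁻ y∈))) (sym (proj₁ (∈-block⁻ z∈))) k<k')

  length-allowedList : length allowedList ≡ suc r' * j + 1
  length-allowedList =
    trans (length-concat (tabulate block))
      (trans (cong sum (map-tabulate block length))
        (sum-tabulate-bump c (length ∘ block)
          (trans (length-map (c ,_) (values (c ≟ c))) (length-values-yes refl (c ≟ c)))
          (λ k k≢c → trans (length-map (k ,_) (values (k ≟ c))) (length-values-no k≢c (k ≟ c)))))

module Partitions (r' n' : ℕ) (π : ColoredPerm r' (suc n')) (mono : Monochromatic π) (j : ℕ) where

  c : Fin (suc r')
  c = πcol π fzero

  key : Fin (suc n') → Fin (suc r') × ℕ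
  key = πval π

  open AllowedValues r' j c
  open Chains {_<_ = _<X_ {r'} {j}} <X-trans <X-irrefl
  open KeyedChains {r = suc r'} {_<_ = _<X_ {r'} {j}} <X-trans <X-irrefl

  IsPartition : Map r' (suc n') j → Set
  IsPartition = IsColoredPPartition (Pπ π) j

  zeros : Vec (XElt r' j) r'
  zeros = Vec.tabulate (λ i → fsuc i , fzero)

  lookup-zeros : ∀ i → lookup zeros i ≡ (fsuc i , fzero)
  lookup-zeros = Vec.lookup∘tabulate _

  -- the premise of condition (iii) for π(i) ≺ π(i'), where π is monochromatic
  key<⇒shifted< : ∀ {i i'} k → key i' <L key i →
                  (proj₁ (key i') -c k , proj₂ (key i')) <L (proj₁ (key i) -c k , proj₂ (key i))
  key<⇒shifted< {i} {i'} k i'<i = inj₂ (cong (_-c k) (mono i' i) , <L-sameColour⇒< (mono i' i) i'<i)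

  shifted<⇒key< : ∀ {i i'} k →
                  (proj₁ (key i') -c k , proj₂ (key i')) <L (proj₁ (key i) -c k , proj₂ (key i)) →
                  key i' <L key i
  shifted<⇒key< {i} {i'} k i'<i = inj₂ (mono i' i , <L-sameColour⇒< (cong (_-c k) (mono i' i)) i'<i)

  isPartition⇒zeros : ∀ {f₀ v} → IsPartition (f₀ , v) → f₀ ≡ zeros
  isPartition⇒zeros {f₀} h =
    trans (sym (Vec.tabulate∘lookup f₀)) (Vec.tabulate-cong (IsColoredPPartition.cond-i h))

  isPartition⇒allowed : ∀ {f₀ v} → IsPartition (f₀ , v) → All Allowed v
  isPartition⇒allowed {v = v} h = All.lookup⁻ λ i x≡j →
    trans (sym (IsColoredPPartition.cond-iv h (qE i) _ (cong (proj₁ (lookup v i) ,_) x≡j)))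
          (mono i fzero)

  -- Equal values at i < i' are ruled out by (iii) unless |π(i)| < |π(i')|.
  isPartition⇒LexSorted : ∀ {f₀ v} → IsPartition (f₀ , v) → LexSorted v key
  isPartition⇒LexSorted {v = v} h {i} {i'} i<i' with IsColoredPPartition.cond-ii h (qE i) (qE i') (qq i<i')
  ... | inj₁ vi<vi'     = inj₁ vi<vi'
  ... | inj₂ toL-vi≡vi' = inj₂ (vi≡vi' , ≮L⇒≥L λ i'<i →
          <X-irrefl (subst (lookup v i <X_) (sym vi≡vi')
            (cond-iii (qE i) (qE i') _ (qq i<i') refl (cong proj₁ (sym vi≡vi'))
                      (key<⇒shifted< (proj₁ (lookup v i)) i'<i))))
    where
      open IsColoredPPartition h using (cond-iii)
      vi≡vi' = toL-injective toL-vi≡vi'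

  LexSorted⇒isPartition : ∀ {v} → All Allowed v → LexSorted v key → IsPartition (zeros , v)
  LexSorted⇒isPartition {v} allowed sorted = record
    { cond-i = lookup-zeros ; cond-ii = cond-ii ; cond-iii = cond-iii ; cond-iv = cond-iv }
    where
      f : Map r' (suc n') j
      f = zeros , v

      cond-ii : ∀ a b → PπOrd a b → toL (app f a) ≤L toL (app f b)
      cond-ii (zeroE i) (zeroE i') (zz i<i') rewrite lookup-zeros i | lookup-zeros i' = inj₁ (inj₁ (s<s i<i'))
      cond-ii (qE i) (qE i') (qq i<i') with sorted i<i'
      ... | inj₁ vi<vi'      = inj₁ vi<vi'
      ... | inj₂ (vi≡vi' , _) = inj₂ (cong toL vi≡vi')

      cond-iii : ∀ a b k → PπOrd a b → proj₁ (app f a) ≡ k → proj₁ (app f b) ≡ k →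
                 (ε (Pπ π) j b -c k , ∣_∣ (Pπ π) j b) <L (ε (Pπ π) j a -c k , ∣_∣ (Pπ π) j a) →
                 toL (app f a) <L toL (app f b)
      cond-iii (zeroE i) (zeroE i') k (zz i<i') fa≡k fb≡k _ rewrite lookup-zeros i | lookup-zeros i' =
        ⊥-elim (ℕ.<-irrefl (cong toℕ (Fin.suc-injective (trans fa≡k (sym fb≡k)))) i<i')
      cond-iii (qE i) (qE i') k (qq i<i') _ _ shifted< with sorted i<i'
      ... | inj₁ vi<vi'         = vi<vi'
      ... | inj₂ (_ , keyi≤keyi') = ⊥-elim (<L⇒≱L (shifted<⇒key< k shifted<) keyi≤keyi')

      cond-iv : ∀ a k → app f a ≡ (k , fromℕ j) → ε (Pπ π) j a ≡ k
      cond-iv (zeroE i) k fa≡ = cong proj₁ (trans (sym (lookup-zeros i)) fa≡)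
      cond-iv (qE i)    k fa≡ =
        trans (mono i fzero) (trans (sym (All.lookup⁺ allowed i (cong proj₂ fa≡))) (cong proj₁ fa≡))

  withZeros : Vec (XElt r' j) (suc n') → Map r' (suc n') j
  withZeros = zeros ,_

  partitions : List (Map r' (suc n') j)
  partitions = map withZeros (chains allowedList (descentPattern key))

  partitions-unique : Unique partitions
  partitions-unique = Unique.map⁺ ,-injectiveʳ (chains-unique _ allowedList-sorted)

  ∈-partitions⁻ : ∀ f → f ∈ partitions → IsPartition f
  ∈-partitions⁻ f f∈ with ∈-map⁻ withZeros f∈
  ... | v , v∈ , refl with ∈-chains⁻ allowedList-sorted v∈
  ...   | v⊆ , ch = LexSorted⇒isPartition (All.map ∈-allowedList⁻ v⊆) (chain⇒LexSorted ch)

  ∈-partitions⁺ : ∀ f → IsPartition f → f ∈ partitions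
  ∈-partitions⁺ (f₀ , v) h = subst (λ z → (z , v) ∈ partitions) (sym (isPartition⇒zeros h))
    (∈-map⁺ withZeros (∈-chains⁺ allowedList-sorted
      (All.map (∈-allowedList⁺ _) (isPartition⇒allowed h))
      (LexSorted⇒chain v key (isPartition⇒LexSorted h))))

  length-partitions : length partitions ≡ (suc r' * j + suc n' ∸ intdes π) C suc n'
  length-partitions = begin
    length partitions                                     ≡⟨ length-map withZeros (chains allowedList (descentPattern key)) ⟩
    length (chains allowedList (descentPattern key))      ≡⟨ length-chains allowedList (descentPattern key) ⟩
    (length allowedList + w) C suc n'                     ≡⟨ cong (λ t → (t + w) C suc n') length-allowedList ⟩
    (suc r' * j + 1 + w) C suc n'                         ≡⟨ cong (_C suc n') (m+[1+n+o]∸n≡m+1+o (suc r' * j) d w) ⟨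
    (suc r' * j + suc (d + w) ∸ d) C suc n'               ≡⟨ cong (λ t → (suc r' * j + suc t ∸ d) C suc n')
                                                                   (descFrom+weakSteps key) ⟩
    (suc r' * j + suc n' ∸ d) C suc n'                    ≡⟨ cong (λ t → (suc r' * j + suc n' ∸ t) C suc n') intdes≡d ⟨
    (suc r' * j + suc n' ∸ intdes π) C suc n'             ∎
    where
      open ≡-Reasoning
      d = descFrom (key fzero) (tabulate (key ∘ fsuc))
      w = weakSteps (descentPattern key)

      intdes≡d : intdes π ≡ d
      intdes≡d = cong descCount (map-tabulate id key)

      m+[1+n+o]∸n≡m+1+o : ∀ m n o → m + suc (n + o) ∸ n ≡ m + 1 + o
      m+[1+n+o]∸n≡m+1+o m n o = trans (cong (_∸ n) (rearrange m n o)) (ℕ.m+n∸n≡m (m + 1 + o) n)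
        where
          rearrange : ∀ m n o → m + suc (n + o) ≡ m + 1 + o + n
          rearrange = solve-∀

mainTheorem5 : ∀ (r' n : ℕ) → 1 ℕ.≤ n → (π : ColoredPerm r' n) → Monochromatic π →
                 ∀ (j : ℕ) → ΩIs (Pπ π) j ((suc r' * j + n ∸ intdes π) C n)
mainTheorem5 r' (suc n') _ π mono j =
  partitions , partitions-unique , ∈-partitions⁻ , ∈-partitions⁺ , length-partitions
  where open Partitions r' n' π mono j
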